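{- Let $G$ be a finite simple graph with at least one isolated vertex such that $G \neq \widetilde G$ (i.e. $G$ has a pair of distinct twin vertices). Then for $t \geq 1$, $\mu_t(\widetilde G) \cong \widetilde{\mu_t(G)} + (t-1)K_1$, where $+$ denotes disjoint union.
   Context: Two vertices $x,y$ are twins, $x\sim y$, if they have the same open neighborhood. The quotient graph $\widetilde G$ has as vertices the equivalence classes $[x]$ of $\sim$, with $[x]$ adjacent to $[z]$ iff some $p\in[x]$ and $q\in[z]$ are adjacent in $G$. For a finite simple graph $G$ with $V(G)=\{v_1,\dots,v_n\}$ and $t\ge 1$, the generalized Mycielskian $\mu_t(G)$ has vertex set $\{u_i^s : 1\le i\le n,\ 0\le s\le t\}\cup\{w\}$, where $u_i^0=v_i$. For each edge $v_iv_j$ of $G$, $\mu_t(G)$ has the edge $u_i^0u_j^0$ and the edges $u_i^su_j^{s+1}$ and $u_j^su_i^{s+1}$ for $0\le s<t$; in addition $u_i^t w$ is an edge for every $i$. There are no other edges. $\widetilde{\mu_t(G)}$ denotes the quotient graph of $\mu_t(G)$. -}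

module Defs where

open import Data.Nat using (ℕ; zero; suc; _∸_)
open import Data.Fin using (Fin; toℕ)
open import Data.Bool using (Bool; true; false)
open import Data.Product using (Σ; ∃; _×_; _,_)
open import Data.Sum using (_⊎_; inj₁; inj₂)
open import Data.Unit using (⊤; tt)
open import Data.Empty using (⊥)
open import Relation.Binary.PropositionalEquality using (_≡_)
open import Relation.Nullary using (¬_)

record FinGraph : Set where
  field
    n      : ℕ
    adj    : Fin n → Fin n → Bool
    sym    : ∀ i j → adj i j ≡ adj j i
    irrefl : ∀ i → adj i i ≡ false
open FinGraph public

Isolated : (G : FinGraph) → Fin (n G) → Set
Isolated G x = ∀ v → adj G x v ≡ false

HasDistinctTwins : FinGraph → Set
HasDistinctTwins G = Σ (Fin (n G)) λ x → Σ (Fin (n G)) λ y →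
  (¬ (x ≡ y)) × (∀ v → adj G x v ≡ adj G y v)

-- Graphs whose vertex set is a setoid (used to represent quotient graphs:
-- vertices of the quotient are the elements of V up to the relation _≈_,
-- i.e. the equivalence classes).

record SGraph : Set₁ where
  field
    V   : Set
    _≈_ : V → V → Set
    E   : V → V → Set
open SGraph public

toS : FinGraph → SGraph
toS G = record { V = Fin (n G) ; _≈_ = _≡_ ; E = λ i j → adj G i j ≡ true }

Twin : (G : SGraph) → V G → V G → Set
Twin G x y = ∀ v → (E G x v → E G y v) × (E G y v → E G x v)

-- quotient graph G̃: vertices are twin classes; [x] ~ [z] iff some
-- p ∈ [x], q ∈ [z] are adjacent.
Quot : SGraph → SGraph
Quot G = record
  { V   = V G
  ; _≈_ = Twin G
  ; E   = λ x z → Σ (V G) λ p → Σ (V G) λ q →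
            Twin G p x × Twin G q z × E G p q
  }

-- generalized Mycielskian μ_t: vertices u_i^s = inj₁ (i , s), w = inj₂ tt
MycV : SGraph → ℕ → Set
MycV G t = (V G × Fin (suc t)) ⊎ ⊤

MycEq : (G : SGraph) (t : ℕ) → MycV G t → MycV G t → Set
MycEq G t (inj₁ (x , s)) (inj₁ (y , s')) = (_≈_ G x y) × (s ≡ s')
MycEq G t (inj₁ _) (inj₂ _) = ⊥
MycEq G t (inj₂ _) (inj₁ _) = ⊥
MycEq G t (inj₂ _) (inj₂ _) = ⊤

MycE : (G : SGraph) (t : ℕ) → MycV G t → MycV G t → Set
MycE G t (inj₁ (x , s)) (inj₁ (y , s')) =
  E G x y × ((toℕ s ≡ 0 × toℕ s' ≡ 0) ⊎ (toℕ s' ≡ suc (toℕ s)) ⊎ (toℕ s ≡ suc (toℕ s')))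
MycE G t (inj₁ (x , s)) (inj₂ _) = toℕ s ≡ t
MycE G t (inj₂ _) (inj₁ (y , s)) = toℕ s ≡ t
MycE G t (inj₂ _) (inj₂ _) = ⊥

Myc : ℕ → SGraph → SGraph
Myc t G = record { V = MycV G t ; _≈_ = MycEq G t ; E = MycE G t }

PlusK1 : SGraph → ℕ → SGraph
PlusK1 G m = record
  { V   = V G ⊎ Fin m
  ; _≈_ = eq
  ; E   = e
  }
  where
  eq : V G ⊎ Fin m → V G ⊎ Fin m → Set
  eq (inj₁ x) (inj₁ y) = _≈_ G x y
  eq (inj₁ _) (inj₂ _) = ⊥
  eq (inj₂ _) (inj₁ _) = ⊥
  eq (inj₂ i) (inj₂ j) = i ≡ j
  e : V G ⊎ Fin m → V G ⊎ Fin m → Set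
  e (inj₁ x) (inj₁ y) = E G x y
  e _ _ = ⊥

record _≅_ (G H : SGraph) : Set where
  field
    to       : V G → V H
    from     : V H → V G
    to-cong  : ∀ {x y} → _≈_ G x y → _≈_ H (to x) (to y)
    from-cong : ∀ {x y} → _≈_ H x y → _≈_ G (from x) (from y)
    from∘to  : ∀ x → _≈_ G (from (to x)) x
    to∘from  : ∀ y → _≈_ H (to (from y)) y
    E-pres   : ∀ x y → E G x y → E H (to x) (to y)
    E-refl   : ∀ x y → E H (to x) (to y) → E G x y

-- In μ_t(G) two vertices u_x^s, u_y^{s'} are twins exactly when x and y are twins in G
-- and either s = s' or x is isolated and s, s' < t: the copies of a non-isolated vertex
-- keep their level, since a level ℓ ≤ t (t ≥ 1) is determined by the set of levels
-- adjacent to it, and every copy of an isolated vertex below level t has empty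
-- neighbourhood.  So the t copies below level t of the isolated twin class collapse to
-- one vertex of the quotient of μ_t(G), whereas μ_t(G̃) keeps them apart; the
-- isomorphism sends the copies at levels 1, …, t − 1 to the t − 1 added vertices.
module Submission where

open import Defs hiding (sym)
open import Data.Nat using (ℕ; zero; suc; _+_; _≤_; _∸_; z≤n; s≤s)
open import Data.Nat.Properties using (_≟_; suc-injective; m≤n⇒m≤1+n)
open import Data.Fin using (Fin; zero; suc; toℕ; inject₁; fromℕ; fromℕ<)
open import Data.Fin.Properties
  using (all?; ¬∀⟶∃¬; toℕ-fromℕ; toℕ-fromℕ<; toℕ-inject₁; toℕ-inject₁-≢; toℕ≤pred[n]; toℕ-injective)
open import Data.Bool using (true; false)
open import Data.Bool.Properties using (¬-not) renaming (_≟_ to _≟ᵇ_)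
open import Data.Product using (Σ; ∃; _×_; _,_; proj₁; proj₂; map₁; swap)
open import Data.Sum using (_⊎_; inj₁; inj₂)
open import Data.Unit using (tt)
open import Function using (id)
open import Relation.Binary.Definitions using (Symmetric)
open import Relation.Nullary using (¬_; Dec; yes; no; contradiction)
open import Relation.Binary.PropositionalEquality
  using (_≡_; _≢_; refl; sym; trans; cong; subst; subst₂)

pattern copy x s = inj₁ (x , s)
pattern hub = inj₂ tt

twin-refl : (H : SGraph) (x : V H) → Twin H x x
twin-refl H x v = id , id

twin-sym : (H : SGraph) {x y : V H} → Twin H x y → Twin H y x
twin-sym H x~y v = swap (x~y v)

edge⇒quot-edge : (H : SGraph) {x y : V H} → E H x y → E (Quot H) x y
edge⇒quot-edge H {x} {y} xy = x , y , twin-refl H x , twin-refl H y , xy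

quot-edge⇒edge : (H : SGraph) → Symmetric (E H) → {x y : V H} → E (Quot H) x y → E H x y
quot-edge⇒edge H E-sym {x} {y} (p , q , p~x , q~y , pq) =
  E-sym (proj₁ (q~y x) (E-sym (proj₁ (p~x q) pq)))

MycE-mono : ∀ {t} {W : Set} {_≈₁_ _≈₂_ E₁ E₂ : W → W → Set} →
  (∀ {x y} → E₁ x y → E₂ x y) →
  ∀ {a b} → MycE (record { V = W ; _≈_ = _≈₁_ ; E = E₁ }) t a b
          → MycE (record { V = W ; _≈_ = _≈₂_ ; E = E₂ }) t a b
MycE-mono f {copy x s} {copy y s'} (xy , ss') = f xy , ss'
MycE-mono f {copy x s} {hub} e = e
MycE-mono f {hub} {copy y s} e = e

plus-edge-inv : ∀ {H m} {c d : V (PlusK1 H m)} → E (PlusK1 H m) c d →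
  ∃ λ a → ∃ λ b → c ≡ inj₁ a × d ≡ inj₁ b × E H a b
plus-edge-inv {c = inj₁ a} {inj₁ b} ab = a , b , refl , refl , ab

LevelAdj : ℕ → ℕ → Set
LevelAdj p q = (p ≡ 0 × q ≡ 0) ⊎ (q ≡ suc p) ⊎ (p ≡ suc q)

levelAdj-sym : Symmetric LevelAdj
levelAdj-sym (inj₁ (p≡0 , q≡0)) = inj₁ (q≡0 , p≡0)
levelAdj-sym (inj₂ (inj₁ q≡1+p)) = inj₂ (inj₂ q≡1+p)
levelAdj-sym (inj₂ (inj₂ p≡1+q)) = inj₂ (inj₁ p≡1+q)

-- Level 0 is adjacent to itself, which distinguishes it from level 1 as soon as T ≥ 1.
levelAdj-injective : ∀ T {a b} → 1 ≤ T → a ≤ T → b ≤ T →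
  (∀ q → q ≤ T → LevelAdj a q → LevelAdj b q) →
  (∀ q → q ≤ T → LevelAdj b q → LevelAdj a q) → a ≡ b
levelAdj-injective T {zero} {zero} _ _ _ _ _ = refl
levelAdj-injective T {zero} {suc b} 1≤T _ _ a⊆b _ with a⊆b 0 z≤n (inj₁ (refl , refl))
... | inj₂ (inj₂ refl) with a⊆b 1 1≤T (inj₂ (inj₁ refl))
...   | inj₁ (() , _)
...   | inj₂ (inj₁ ())
...   | inj₂ (inj₂ ())
levelAdj-injective T {suc a} {zero} 1≤T a≤T b≤T a⊆b b⊆a =
  sym (levelAdj-injective T 1≤T b≤T a≤T b⊆a a⊆b)
levelAdj-injective T {suc a} {suc b} _ (s≤s a<T) (s≤s b<T) a⊆b b⊆a
  with a⊆b a (m≤n⇒m≤1+n a<T) (inj₂ (inj₂ refl))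
... | inj₂ (inj₂ refl) = refl
... | inj₂ (inj₁ refl) with b⊆a b (m≤n⇒m≤1+n b<T) (inj₂ (inj₂ refl))
...   | inj₂ (inj₁ ())
...   | inj₂ (inj₂ ())

isolated? : (G : FinGraph) (x : Fin (n G)) → Dec (Isolated G x)
isolated? G x = all? (λ v → adj G x v ≟ᵇ false)

isolated-no-edge : (G : FinGraph) {x : Fin (n G)} → Isolated G x → ∀ v → adj G x v ≢ true
isolated-no-edge G x-iso v xv with trans (sym (x-iso v)) xv
... | ()

isolated-twin : (G : FinGraph) {x y : Fin (n G)} → Isolated G x → Twin (toS G) x y → Isolated G y
isolated-twin G x-iso x~y v = ¬-not λ yv → isolated-no-edge G x-iso v (proj₂ (x~y v) yv)

isolated-twins : (G : FinGraph) {x y : Fin (n G)} → Isolated G x → Isolated G y → Twin (toS G) x y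
isolated-twins G x-iso y-iso v =
  (λ xv → contradiction xv (isolated-no-edge G x-iso v)) ,
  (λ yv → contradiction yv (isolated-no-edge G y-iso v))

non-isolated-neighbour : (G : FinGraph) {x : Fin (n G)} → ¬ Isolated G x → ∃ λ z → adj G x z ≡ true
non-isolated-neighbour G {x} x-not-iso with ¬∀⟶∃¬ (n G) _ (λ v → adj G x v ≟ᵇ false) x-not-iso
... | z , xz≢false = z , ¬-not xz≢false

module MycielskianTwins (G : FinGraph) (T : ℕ) where

  private
    SG = toS G
    MG = Myc T (toS G)

  adj-sym : Symmetric (E SG)
  adj-sym {x} {y} xy = trans (FinGraph.sym G y x) xy

  MycE-sym : Symmetric (E MG)
  MycE-sym {copy x s} {copy y s'} (xy , ss') = adj-sym xy , levelAdj-sym ss'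
  MycE-sym {copy x s} {hub} e = e
  MycE-sym {hub} {copy y s} e = e

  twin-lift : ∀ {x y} s → Twin SG x y → Twin MG (copy x s) (copy y s)
  twin-lift s x~y (copy z s') = map₁ (proj₁ (x~y z)) , map₁ (proj₂ (x~y z))
  twin-lift s x~y hub = id , id

  down : Fin (suc T) → Fin (suc T)
  down zero = zero
  down (suc s) = inject₁ s

  levelAdj-down : ∀ s → LevelAdj (toℕ s) (toℕ (down s))
  levelAdj-down zero = inj₁ (refl , refl)
  levelAdj-down (suc s) = inj₂ (inj₂ (cong suc (sym (toℕ-inject₁ s))))

  twin-base : ∀ {x y s s'} → Twin MG (copy x s) (copy y s') → Twin SG x y
  twin-base {s = s} {s'} x~y v =
    (λ xv → proj₁ (proj₁ (x~y (copy v (down s))) (xv , levelAdj-down s))) ,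
    (λ yv → proj₁ (proj₂ (x~y (copy v (down s'))) (yv , levelAdj-down s')))

  twin-levelAdj : ∀ {x y z s s'} → adj G x z ≡ true → Twin MG (copy x s) (copy y s') →
    ∀ q → q ≤ T → LevelAdj (toℕ s) q → LevelAdj (toℕ s') q
  twin-levelAdj {z = z} {s} {s'} xz x~y q q≤T sq =
    subst (LevelAdj (toℕ s')) q′≡q
      (proj₂ (proj₁ (x~y (copy z q′)) (xz , subst (LevelAdj (toℕ s)) (sym q′≡q) sq)))
    where
    q′ = fromℕ< (s≤s q≤T)
    q′≡q = toℕ-fromℕ< (s≤s q≤T)

  twin-level : 1 ≤ T → ∀ {x y z s s'} → adj G x z ≡ true →
    Twin MG (copy x s) (copy y s') → s ≡ s'
  twin-level 1≤T {z = z} {s} {s'} xz x~y = toℕ-injective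
    (levelAdj-injective T 1≤T (toℕ≤pred[n] s) (toℕ≤pred[n] s')
      (twin-levelAdj xz x~y) (twin-levelAdj yz (twin-sym MG x~y)))
    where yz = proj₁ (twin-base x~y z) xz

  twin-top : ∀ {x y s s'} → Twin MG (copy x s) (copy y s') → toℕ s ≡ T → toℕ s' ≡ T
  twin-top x~y = proj₁ (x~y hub)

  isolated-copy-no-edge : ∀ {x s} → Isolated G x → toℕ s ≢ T → ∀ v → ¬ E MG (copy x s) v
  isolated-copy-no-edge x-iso s≢T (copy z _) (xz , _) = isolated-no-edge G x-iso z xz
  isolated-copy-no-edge x-iso s≢T hub s≡T = s≢T s≡T

  isolated-copies-twin : ∀ {x s s'} → Isolated G x → toℕ s ≢ T → toℕ s' ≢ T →
    Twin MG (copy x s) (copy x s')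
  isolated-copies-twin x-iso s≢T s'≢T v =
    (λ e → contradiction e (isolated-copy-no-edge x-iso s≢T v)) ,
    (λ e → contradiction e (isolated-copy-no-edge x-iso s'≢T v))

  -- The hub is adjacent to the top copy of an isolated vertex, which no copy is adjacent to.
  ¬twin-copy-hub : ∀ {v₀} → Isolated G v₀ → ∀ {x s} → ¬ Twin MG (copy x s) hub
  ¬twin-copy-hub {v₀} v₀-iso {x} x~w =
    isolated-no-edge G v₀-iso x (adj-sym (proj₁ (proj₂ (x~w (copy v₀ (fromℕ T))) (toℕ-fromℕ T))))

data Level (t : ℕ) : Fin (2 + t) → Set where
  bottom : Level t zero
  middle : (k : Fin t) → Level t (suc (inject₁ k))
  top    : Level t (fromℕ (suc t))

level : ∀ {t} (s : Fin (2 + t)) → Level t s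
level zero = bottom
level {zero} (suc zero) = top
level {suc t} (suc s) with level s
... | bottom = middle zero
... | middle k = middle (suc k)
... | top = top

level-middle : ∀ {t} (k : Fin t) → level (suc (inject₁ k)) ≡ middle k
level-middle zero = refl
level-middle (suc k) rewrite level-middle k = refl

middle-not-top : ∀ {t} (k : Fin t) → toℕ (suc (inject₁ k)) ≢ suc t
middle-not-top k e = toℕ-inject₁-≢ k (sym (suc-injective e))

module Isomorphism (G : FinGraph) {v₀ : Fin (n G)} (v₀-iso : Isolated G v₀) (t : ℕ) where

  open MycielskianTwins G (suc t)

  private
    T = suc t
    SG = toS G
    MG = Myc T SG
    Domain = Myc T (Quot SG)
    Codomain = PlusK1 (Quot MG) t

  IsMiddle : Fin (suc T) → Set
  IsMiddle s = ∃ λ k → s ≡ suc (inject₁ k)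

  top-not-middle : ∀ {s} → toℕ s ≡ T → ¬ IsMiddle s
  top-not-middle s≡T (k , refl) = middle-not-top k s≡T

  place : ∀ x {s} → Level t s → Dec (Isolated G x) → V Codomain
  place x (middle k) (yes _) = inj₂ k
  place x {s} _ _ = inj₁ (copy x s)

  to : V Domain → V Codomain
  to (copy x s) = place x (level s) (isolated? G x)
  to hub = inj₁ hub

  -- Chooses level 0 as the representative of the copies of an isolated vertex below the top.
  collapseLevel : Fin (suc T) → Fin (suc T)
  collapseLevel s with toℕ s ≟ T
  ... | yes _ = s
  ... | no _ = zero

  collapse : ∀ x → Fin (suc T) → Dec (Isolated G x) → V Domain
  collapse x s (yes _) = copy x (collapseLevel s)
  collapse x s (no _) = copy x s

  from : V Codomain → V Domain
  from (inj₁ (copy x s)) = collapse x s (isolated? G x)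
  from (inj₁ hub) = hub
  from (inj₂ k) = copy v₀ (suc (inject₁ k))

  to-fixed : ∀ x s → ¬ Isolated G x ⊎ ¬ IsMiddle s → to (copy x s) ≡ inj₁ (copy x s)
  to-fixed x s = place-fixed (level s) (isolated? G x)
    where
    place-fixed : ∀ {s} (l : Level t s) d → ¬ Isolated G x ⊎ ¬ IsMiddle s → place x l d ≡ inj₁ (copy x s)
    place-fixed (middle k) (yes x-iso) (inj₁ x-not-iso) = contradiction x-iso x-not-iso
    place-fixed (middle k) (yes _) (inj₂ not-middle) = contradiction (k , refl) not-middle
    place-fixed (middle k) (no _) _ = refl
    place-fixed bottom _ _ = refl
    place-fixed top _ _ = refl

  to-inj₁ : ∀ a {c} → to a ≡ inj₁ c → c ≡ a
  to-inj₁ (copy x s) = place-inj₁ (level s) (isolated? G x)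
    where
    place-inj₁ : ∀ {s c} (l : Level t s) d → place x l d ≡ inj₁ c → c ≡ copy x s
    place-inj₁ (middle k) (yes _) ()
    place-inj₁ (middle k) (no _) refl = refl
    place-inj₁ bottom _ refl = refl
    place-inj₁ top _ refl = refl
  to-inj₁ hub refl = refl

  to-middle : ∀ k → to (copy v₀ (suc (inject₁ k))) ≡ inj₂ k
  to-middle k rewrite level-middle k with isolated? G v₀
  ... | yes _ = refl
  ... | no v₀-not-iso = contradiction v₀-iso v₀-not-iso

  collapseLevel-top : ∀ {s} → toℕ s ≡ T → collapseLevel s ≡ s
  collapseLevel-top {s} s≡T with toℕ s ≟ T
  ... | yes _ = refl
  ... | no s≢T = contradiction s≡T s≢T

  collapseLevel-not-middle : ∀ s → ¬ IsMiddle (collapseLevel s)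
  collapseLevel-not-middle s with toℕ s ≟ T
  ... | yes s≡T = top-not-middle s≡T
  ... | no _ = λ { (k , ()) }

  collapseLevel-twin : ∀ {x} s → Isolated G x → Twin MG (copy x (collapseLevel s)) (copy x s)
  collapseLevel-twin s x-iso with toℕ s ≟ T
  ... | yes _ = twin-refl MG (copy _ s)
  ... | no s≢T = isolated-copies-twin x-iso (λ ()) s≢T

  collapseLevel-cong : ∀ {x y s s'} → Twin MG (copy x s) (copy y s') → collapseLevel s ≡ collapseLevel s'
  collapseLevel-cong {s = s} {s'} xs~ys' with toℕ s ≟ T | toℕ s' ≟ T
  ... | yes s≡T | yes s'≡T = toℕ-injective (trans s≡T (sym s'≡T))
  ... | yes s≡T | no s'≢T = contradiction (twin-top xs~ys' s≡T) s'≢T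
  ... | no s≢T | yes s'≡T = contradiction (twin-top (twin-sym MG xs~ys') s'≡T) s≢T
  ... | no _ | no _ = refl

  from-fixed : ∀ x s → ¬ Isolated G x ⊎ collapseLevel s ≡ s →
    _≈_ Domain (from (inj₁ (copy x s))) (copy x s)
  from-fixed x s = collapse-fixed (isolated? G x)
    where
    collapse-fixed : ∀ d → ¬ Isolated G x ⊎ collapseLevel s ≡ s → _≈_ Domain (collapse x s d) (copy x s)
    collapse-fixed (yes x-iso) (inj₁ x-not-iso) = contradiction x-iso x-not-iso
    collapse-fixed (yes _) (inj₂ fixed) = twin-refl SG x , fixed
    collapse-fixed (no _) _ = twin-refl SG x , refl

  from∘to : ∀ a → _≈_ Domain (from (to a)) a
  from∘to (copy x s) = from-place (level s) (isolated? G x)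
    where
    from-place : ∀ {s} (l : Level t s) d → _≈_ Domain (from (place x l d)) (copy x s)
    from-place (middle k) (yes x-iso) = isolated-twins G v₀-iso x-iso , refl
    from-place (middle k) (no x-not-iso) = from-fixed x _ (inj₁ x-not-iso)
    from-place bottom _ = from-fixed x zero (inj₂ refl)
    from-place top _ = from-fixed x (fromℕ T) (inj₂ (collapseLevel-top (toℕ-fromℕ T)))
  from∘to hub = tt

  to∘from : ∀ c → _≈_ Codomain (to (from c)) c
  to∘from (inj₁ (copy x s)) = to-collapse (isolated? G x)
    where
    to-collapse : ∀ d → _≈_ Codomain (to (collapse x s d)) (inj₁ (copy x s))
    to-collapse (yes x-iso)
      rewrite to-fixed x (collapseLevel s) (inj₂ (collapseLevel-not-middle s)) = collapseLevel-twin s x-iso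
    to-collapse (no x-not-iso) rewrite to-fixed x s (inj₁ x-not-iso) = twin-refl MG (copy x s)
  to∘from (inj₁ hub) = twin-refl MG hub
  to∘from (inj₂ k) rewrite to-middle k = refl

  to-cong : ∀ {a b} → _≈_ Domain a b → _≈_ Codomain (to a) (to b)
  to-cong {copy x s} {copy y .s} (x~y , refl) = place-cong (level s) (isolated? G x) (isolated? G y)
    where
    place-cong : ∀ {s} (l : Level t s) dx dy → _≈_ Codomain (place x l dx) (place y l dy)
    place-cong (middle k) (yes _) (yes _) = refl
    place-cong (middle k) (yes x-iso) (no y-not-iso) = contradiction (isolated-twin G x-iso x~y) y-not-iso
    place-cong (middle k) (no x-not-iso) (yes y-iso) =
      contradiction (isolated-twin G y-iso (twin-sym SG x~y)) x-not-iso
    place-cong (middle k) (no _) (no _) = twin-lift _ x~y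
    place-cong bottom _ _ = twin-lift _ x~y
    place-cong top _ _ = twin-lift _ x~y
  to-cong {hub} {hub} _ = twin-refl MG hub

  from-cong : ∀ {c d} → _≈_ Codomain c d → _≈_ Domain (from c) (from d)
  from-cong {inj₁ (copy x s)} {inj₁ (copy y s')} xs~ys' = collapse-cong (isolated? G x) (isolated? G y)
    where
    x~y = twin-base xs~ys'
    collapse-cong : ∀ dx dy → _≈_ Domain (collapse x s dx) (collapse y s' dy)
    collapse-cong (yes _) (yes _) = x~y , collapseLevel-cong xs~ys'
    collapse-cong (yes x-iso) (no y-not-iso) = contradiction (isolated-twin G x-iso x~y) y-not-iso
    collapse-cong (no x-not-iso) (yes y-iso) =
      contradiction (isolated-twin G y-iso (twin-sym SG x~y)) x-not-iso
    collapse-cong (no x-not-iso) (no _) =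
      x~y , twin-level (s≤s z≤n) (proj₂ (non-isolated-neighbour G x-not-iso)) xs~ys'
  from-cong {inj₁ (copy x s)} {inj₁ hub} xs~w = contradiction xs~w (¬twin-copy-hub v₀-iso)
  from-cong {inj₁ hub} {inj₁ (copy y s)} w~ys = contradiction (twin-sym MG w~ys) (¬twin-copy-hub v₀-iso)
  from-cong {inj₁ hub} {inj₁ hub} _ = tt
  from-cong {inj₂ k} {inj₂ .k} refl = twin-refl SG v₀ , refl

  domain-edge⇒myc-edge : ∀ {a b} → E Domain a b → E MG a b
  domain-edge⇒myc-edge = MycE-mono (quot-edge⇒edge SG adj-sym)

  myc-edge⇒domain-edge : ∀ {a b} → E MG a b → E Domain a b
  myc-edge⇒domain-edge = MycE-mono (edge⇒quot-edge SG)

  to-fixed-on-edge : ∀ {a b} → E Domain a b → to a ≡ inj₁ a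
  to-fixed-on-edge {copy x s} {copy y _} (xy , _) =
    to-fixed x s (inj₁ λ x-iso → isolated-no-edge G x-iso y (quot-edge⇒edge SG adj-sym xy))
  to-fixed-on-edge {copy x s} {hub} s≡T = to-fixed x s (inj₂ (top-not-middle s≡T))
  to-fixed-on-edge {hub} _ = refl

  E-pres : ∀ a b → E Domain a b → E Codomain (to a) (to b)
  E-pres a b ab = subst₂ (E Codomain) (sym (to-fixed-on-edge ab)) (sym (to-fixed-on-edge ba))
    (edge⇒quot-edge MG (domain-edge⇒myc-edge ab))
    where ba = myc-edge⇒domain-edge (MycE-sym (domain-edge⇒myc-edge ab))

  E-refl : ∀ a b → E Codomain (to a) (to b) → E Domain a b
  E-refl a b e with plus-edge-inv e
  ... | a′ , b′ , p , q , a′b′ = subst₂ (E Domain) (to-inj₁ a p) (to-inj₁ b q)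
    (myc-edge⇒domain-edge (quot-edge⇒edge MG MycE-sym a′b′))

  iso : Domain ≅ Codomain
  iso = record
    { to = to ; from = from
    ; to-cong = to-cong ; from-cong = λ {c} {d} → from-cong {c} {d}
    ; from∘to = from∘to ; to∘from = to∘from
    ; E-pres = E-pres ; E-refl = E-refl
    }

lemma3p15 : (G : FinGraph) → Σ (Fin (n G)) (Isolated G) → HasDistinctTwins G →
    (t : ℕ) → 1 ≤ t →
    Myc t (Quot (toS G)) ≅ PlusK1 (Quot (Myc t (toS G))) (t ∸ 1)
lemma3p15 G (v₀ , v₀-iso) _ (suc t) _ = Isomorphism.iso G v₀-iso t
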